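{- A language over a finite alphabet $\Sigma$ is regular if and only if it is the language $L(\mathbb{A})$ of some stopwatch automaton $\mathbb{A}$.
   Context: A language is regular if it is accepted by some nondeterministic finite automaton. A (specific) stopwatch automaton is a tuple $\mathbb{A}=(Q,\Sigma,X,\lambda,\beta,\zeta,\Delta)$ where $Q$ is a finite set of states containing two distinguished states $\mathit{start}$ and $\mathit{accept}$; $\Sigma$ is a finite nonempty alphabet; $X$ is a finite set of stopwatches; $\lambda:Q\to\Sigma$; $\beta:X\to\mathbb{N}$ assigns each stopwatch its bound; $\zeta\subseteq X\times Q$ ($x$ is active in $q$ iff $(x,q)\in\zeta$); $\Delta$ is a finite set of transitions $(q,g,\alpha,q')$ with $g$ a guard and $\alpha$ an action. An assignment is $\xi:X\to\mathbb{N}$ with $\xi(x)\le\beta(x)$. Guards are Boolean circuits taking the binary encoding of an assignment (a block of $\lceil\log(\beta(x)+1)\rceil$ bits per stopwatch) and outputting one bit; actions are Boolean circuits mapping such encodings to encodings of numbers $v_x$, the resulting assignment being $x\mapsto\min\{v_x,\beta(x)\}$. Edges $(q,\xi)\stackrel{t}{\to}(q',\xi')$ between nodes (state, assignment): either $t=0$ and some $(q,g,\alpha,q')\in\Delta$ has $\xi$ satisfying $g$ and $\alpha(\xi)=\xi'$; or $t>0$, $q=q'$, and $\xi'(x)=\min\{\xi(x)+t,\beta(x)\}$ for $x$ active in $q$, $\xi'(x)=\xi(x)$ otherwise. A computation is a sequence $(q_0,\xi_0)\stackrel{t_0}{\to}\cdots\stackrel{t_{\ell-1}}{\to}(q_\ell,\xi_\ell)$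 with $q_i\ne\mathit{accept}$ for $i<\ell$; it is initial if $q_0=\mathit{start}$ and $\xi_0\equiv0$, accepting if $q_\ell=\mathit{accept}$, and reads $\lambda(q_0)^{t_0}\cdots\lambda(q_{\ell-1})^{t_{\ell-1}}$. $L(\mathbb{A})$ is the set of words read by initial accepting computations. -}

module Defs where

open import Data.Nat using (ℕ; zero; suc; _+_; _*_; _<_; _⊔_; _⊓_)
open import Data.Nat.DivMod using (_/_; _%_)
open import Data.Nat.Logarithm using (⌈log₂_⌉)
open import Data.Bool using (Bool; true; false; _∧_; _∨_; not; if_then_else_)
open import Data.Fin using (Fin; zero; suc)
open import Data.Vec using (Vec; []; _∷_; lookup; splitAt; _++_)
open import Data.List using (List; []; _∷_; replicate) renaming (_++_ to _++ᴸ_)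
open import Data.List.Membership.Propositional using (_∈_)
open import Data.Product using (Σ; _×_; _,_; proj₁; proj₂; ∃)
open import Relation.Binary.PropositionalEquality using (_≡_; _≢_)
open import Function.Bundles using (_⇔_)

Language : Set → Set₁
Language A = List A → Set

record NFA (A : Set) : Set where
  field
    nStates : ℕ
    initial : Fin nStates → Bool
    final   : Fin nStates → Bool
    δ       : Fin nStates → A → Fin nStates → Bool

module _ {A : Set} (N : NFA A) where
  open NFA N
  data Run : Fin nStates → List A → Set where
    stop : ∀ {q} → final q ≡ true → Run q []
    move : ∀ {q q' a w} → δ q a q' ≡ true → Run q' w → Run q (a ∷ w)

  NFALang : Language A
  NFALang w = Σ (Fin nStates) λ q → initial q ≡ true × Run q w

Regular : {A : Set} → Language A → Set
Regular {A} L = Σ (NFA A) λ N → ∀ w → L w ⇔ NFALang N w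

-- Boolean circuits with n input bits and m output bits.
-- Wires are stored newest-first: after g gates there are g + n wires.

data Gate (w : ℕ) : Set where
  const : Bool → Gate w
  ¬g    : Fin w → Gate w
  ∧g ∨g : Fin w → Fin w → Gate w

evalGate : ∀ {w} → Gate w → Vec Bool w → Bool
evalGate (const b) v = b
evalGate (¬g i)   v = not (lookup v i)
evalGate (∧g i j) v = lookup v i ∧ lookup v j
evalGate (∨g i j) v = lookup v i ∨ lookup v j

data Gates (n : ℕ) : ℕ → Set where
  []  : Gates n 0
  _▷_ : ∀ {g} → Gates n g → Gate (g + n) → Gates n (suc g)

evalGates : ∀ {n g} → Gates n g → Vec Bool n → Vec Bool (g + n)
evalGates []         inp = inp
evalGates (gs ▷ gt) inp = let v = evalGates gs inp in evalGate gt v ∷ v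

record Circuit (n m : ℕ) : Set where
  constructor circuit
  field
    size    : ℕ
    gates   : Gates n size
    outputs : Vec (Fin (size + n)) m

evalCircuit : ∀ {n m} → Circuit n m → Vec Bool n → Vec Bool m
evalCircuit {n} (circuit s gs outs) inp = go outs
  where
    wires = evalGates gs inp
    go : ∀ {k} → Vec (Fin (s + n)) k → Vec Bool k
    go []       = []
    go (o ∷ os) = lookup wires o ∷ go os

-- Binary encodings (least significant bit first).

bits : ℕ → ℕ
bits b = ⌈log₂ suc b ⌉

encodeNat : (w : ℕ) → ℕ → Vec Bool w
encodeNat zero    v = []
encodeNat (suc w) v = isOne (v % 2) ∷ encodeNat w (v / 2)
  where
    isOne : ℕ → Bool
    isOne (suc zero) = true
    isOne _          = false

decodeNat : ∀ {w} → Vec Bool w → ℕ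
decodeNat []       = 0
decodeNat (b ∷ bs) = (if b then 1 else 0) + 2 * decodeNat bs

width : (k : ℕ) → (Fin k → ℕ) → ℕ
width zero    β = 0
width (suc k) β = bits (β zero) + width k (λ x → β (suc x))

encodeAssign : (k : ℕ) (β : Fin k → ℕ) → (Fin k → ℕ) → Vec Bool (width k β)
encodeAssign zero    β ξ = []
encodeAssign (suc k) β ξ =
  encodeNat (bits (β zero)) (ξ zero) ++ encodeAssign k (λ x → β (suc x)) (λ x → ξ (suc x))

decodeAssign : (k : ℕ) (β : Fin k → ℕ) → Vec Bool (width k β) → (Fin k → ℕ)
decodeAssign zero    β v ()
decodeAssign (suc k) β v x with splitAt (bits (β zero)) v
decodeAssign (suc k) β v zero    | (u , r , _) = decodeNat u
decodeAssign (suc k) β v (suc x) | (u , r , _) = decodeAssign k (λ y → β (suc y)) r x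

record Transition (nQ W : ℕ) : Set where
  constructor trans
  field
    source : Fin nQ
    guard  : Circuit W 1
    action : Circuit W W
    target : Fin nQ

record SWA (s : ℕ) : Set where
  field
    nQ     : ℕ
    start  : Fin nQ
    accept : Fin nQ
    label  : Fin nQ → Fin (suc s)
    nX     : ℕ
    bound  : Fin nX → ℕ
    active : Fin nX → Fin nQ → Bool
    Δ      : List (Transition nQ (width nX bound))

module SWASemantics {s : ℕ} (𝔸 : SWA s) where
  open SWA 𝔸

  Assignment : Set
  Assignment = Σ (Fin nX → ℕ) λ ξ → ∀ x → ξ x Data.Nat.≤ bound x

  Node : Set
  Node = Fin nQ × Assignment

  enc : Assignment → Vec Bool (width nX bound)
  enc ξ = encodeAssign nX bound (proj₁ ξ)

  data Edge : Node → ℕ → Node → Set where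
    discrete : ∀ {q ξ q' ξ'} (tr : Transition nQ (width nX bound)) → tr ∈ Δ →
               Transition.source tr ≡ q → Transition.target tr ≡ q' →
               lookup (evalCircuit (Transition.guard tr) (enc ξ)) zero ≡ true →
               (∀ x → proj₁ ξ' x ≡
                  decodeAssign nX bound (evalCircuit (Transition.action tr) (enc ξ)) x ⊓ bound x) →
               Edge (q , ξ) 0 (q' , ξ')
    delay    : ∀ {q ξ ξ' t} → 0 < t →
               (∀ x → proj₁ ξ' x ≡
                  (if active x q then (proj₁ ξ x + t) ⊓ bound x else proj₁ ξ x)) →
               Edge (q , ξ) t (q , ξ')

  data Computation : Node → Node → List (Fin (suc s)) → Set where
    here : ∀ {n} → Computation n n []
    next : ∀ {q ξ t n m w} → q ≢ accept → Edge (q , ξ) t n → Computation n m w →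
           Computation (q , ξ) m (replicate t (label q) ++ᴸ w)

  zeroAssign : Assignment
  zeroAssign = (λ _ → 0) , (λ _ → Data.Nat.z≤n)

  SWALang : Language (Fin (suc s))
  SWALang w = Σ Assignment λ ξ → Computation (start , zeroAssign) (accept , ξ) w

{-# OPTIONS --safe #-}
module Submission where

-- A regular language is accepted by a stopwatch automaton with a single stopwatch, bounded by 2,
-- active everywhere and reset by every transition. Besides start and accept, its states are the
-- pairs (a, p) of a letter and an NFA state, labelled a; a transition leaves (a, p) only when the
-- stopwatch reads exactly 1 and leaves start only when it reads 0, so exactly one a is read in
-- (a, p), and the transitions out of (a, p) mirror the NFA transitions out of p.
--
-- Conversely, since stopwatches are bounded, a stopwatch automaton has finitely many nodes. Its
-- computations are the runs of an ε-NFA on the nodes whose ε-moves are the discrete edges and whose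
-- a-moves are the delays by one time unit in states labelled a: a delay by t + 1 is t + 1 unit
-- delays, as ((v ⊓ β) + t) ⊓ β = (v + t) ⊓ β. The ε-moves are then eliminated, which only needs the
-- reflexive-transitive closure of a decidable relation on a finite set to be decidable; it is the
-- least fixed point of an inflationary map on subsets, reached after at most k iterations.

open import Defs hiding (trans)
open import Data.Bool using (Bool; true; false; if_then_else_)
open import Data.Bool.Properties using () renaming (_≟_ to _≟ᵇ_)
open import Data.Empty using (⊥; ⊥-elim)
open import Data.Fin using (Fin; zero; suc; toℕ; fromℕ<; combine; remQuot)
open import Data.Fin.Properties
  using (any?; all?; toℕ<n; toℕ-fromℕ<; remQuot-combine) renaming (_≟_ to _≟ᶠ_)
open import Data.Fin.Subset using (Subset; _∈_; _⊆_; _⊂_; _∪_; ⁅_⁆; ∣_∣)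
open import Data.Fin.Subset.Properties
  using (_∈?_; p⊂q⇒∣p∣<∣q∣; ∣p∣≤n; x∈⁅x⁆; x∈⁅y⁆⇒x≡y; p⊆p∪q; x∈p∪q⁺; x∈p∪q⁻)
open import Data.List using (List; []; _∷_; replicate; allFin; cartesianProductWith)
  renaming (_++_ to _++ᴸ_)
open import Data.List.Membership.Propositional using (find; lose)
open import Data.List.Membership.Propositional.Properties
  using (∈-cartesianProductWith⁺; ∈-cartesianProductWith⁻; ∈-allFin)
open import Data.List.Relation.Unary.Any using (Any) renaming (any? to anyᴸ?)
open import Data.Nat using (ℕ; zero; suc; _+_; _*_; _≤_; _<_; _⊓_; z≤n; s≤s)
open import Data.Nat.GeneralisedArithmetic using (iterate)
open import Data.Nat.Properties
  using ( ≤-trans; ≤-reflexive; ≤-pred; <-irrefl; <-≤-trans; m≤m+n; +-suc; +-monoʳ-≤; +-assoc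
        ; m≥n⇒m⊓n≡n; m⊓n≤n; +-distribʳ-⊓; ⊓-assoc; ⊓-glb)
  renaming (_≟_ to _≟ℕ_)
open import Data.Product using (Σ; ∃; _×_; _,_; proj₁; proj₂; uncurry; map₂)
open import Data.Sum using (_⊎_; inj₁; inj₂)
open import Data.Vec using ([]; _∷_; lookup; tabulate; _++_)
open import Data.Vec.Properties using (lookup∘tabulate; lookup⇒[]=; []=⇒lookup)
open import Function using (_∘_)
open import Function.Bundles using (_⇔_; mk⇔)
open import Function.Construct.Composition using (_⇔-∘_)
open import Function.Construct.Symmetry using (⇔-sym)
open import Level using (0ℓ)
open import Relation.Binary using (Rel; Decidable)
open import Relation.Binary.Construct.Closure.ReflexiveTransitive using (Star; ε; _◅_; _◅◅_)
open import Relation.Binary.PropositionalEquality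
  using (_≡_; _≢_; refl; sym; trans; cong; cong₂; subst; _≗_; module ≡-Reasoning)
open import Relation.Nullary using (Dec; yes; no; does; ¬?)
open import Relation.Nullary.Decidable using (_×-dec_; dec-true; decidable-stable; map′)

open ≡-Reasoning

does-true : ∀ {P : Set} (P? : Dec P) → does P? ≡ true → P
does-true (yes p) _ = p

module _ {k : ℕ} {P : Fin k → Set} (P? : ∀ x → Dec (P x)) where

  decSubset : Subset k
  decSubset = tabulate (λ x → does (P? x))

  ∈-decSubset⁺ : ∀ {x} → P x → x ∈ decSubset
  ∈-decSubset⁺ {x} px =
    lookup⇒[]= x decSubset (trans (lookup∘tabulate _ x) (dec-true (P? x) px))

  ∈-decSubset⁻ : ∀ {x} → x ∈ decSubset → P x
  ∈-decSubset⁻ {x} x∈ = does-true (P? x) (trans (sym (lookup∘tabulate _ x)) ([]=⇒lookup x∈))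

module Inflationary {k : ℕ} (f : Subset k → Subset k) (inflationary : ∀ p → p ⊆ f p) where

  ⊆-iterate : ∀ m p → p ⊆ iterate f p m
  ⊆-iterate zero    p x∈p = x∈p
  ⊆-iterate (suc m) p x∈p = ⊆-iterate m (f p) (inflationary p x∈p)

  closed⊎grows : ∀ p → f p ⊆ p ⊎ p ⊂ f p
  closed⊎grows p with any? (λ x → x ∈? f p ×-dec ¬? (x ∈? p))
  ... | yes (x , x∈fp , x∉p) = inj₂ (inflationary p , x , x∈fp , x∉p)
  ... | no ∄x = inj₁ λ {x} x∈fp → decidable-stable (x ∈? p) (λ x∉p → ∄x (x , x∈fp , x∉p))

  iterate-closes : ∀ p → ∃ λ m → f (iterate f p m) ⊆ iterate f p m
  iterate-closes p = go k p (m≤m+n k ∣ p ∣)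
    where
    go : ∀ n p → k ≤ n + ∣ p ∣ → ∃ λ m → f (iterate f p m) ⊆ iterate f p m
    go n p k≤n+∣p∣ with closed⊎grows p
    ... | inj₁ fp⊆p = 0 , fp⊆p
    go zero p k≤∣p∣ | inj₂ p⊂fp =
      ⊥-elim (<-irrefl refl (<-≤-trans (p⊂q⇒∣p∣<∣q∣ p⊂fp) (≤-trans (∣p∣≤n (f p)) k≤∣p∣)))
    go (suc n) p k≤n+∣p∣ | inj₂ p⊂fp with go n (f p) k≤n+∣fp∣
      where
      k≤n+∣fp∣ : k ≤ n + ∣ f p ∣
      k≤n+∣fp∣ = ≤-trans k≤n+∣p∣
        (≤-trans (≤-reflexive (sym (+-suc n ∣ p ∣))) (+-monoʳ-≤ n (p⊂q⇒∣p∣<∣q∣ p⊂fp)))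
    ... | m , closed = suc m , closed

module _ {k : ℕ} {R : Rel (Fin k) 0ℓ} (R? : Decidable R) where

  successor? : ∀ p j → Dec (∃ λ i → i ∈ p × R i j)
  successor? p j = any? (λ i → i ∈? p ×-dec R? i j)

  expand : Subset k → Subset k
  expand p = p ∪ decSubset (successor? p)

  open Inflationary expand (λ p → p⊆p∪q _)

  ∈-iterate-expand⇒reachable : ∀ m p {j} → j ∈ iterate expand p m → ∃ λ i → i ∈ p × Star R i j
  ∈-iterate-expand⇒reachable zero    p {j} j∈p = j , j∈p , ε
  ∈-iterate-expand⇒reachable (suc m) p j∈ with ∈-iterate-expand⇒reachable m (expand p) j∈
  ... | i , i∈expand , i⋆j with x∈p∪q⁻ p _ i∈expand
  ...   | inj₁ i∈p = i , i∈p , i⋆j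
  ...   | inj₂ i∈succ with ∈-decSubset⁻ (successor? p) i∈succ
  ...     | l , l∈p , Rli = l , l∈p , Rli ◅ i⋆j

  star-closed : ∀ {p} → expand p ⊆ p → ∀ {i j} → i ∈ p → Star R i j → j ∈ p
  star-closed closed i∈p ε          = i∈p
  star-closed closed i∈p (Rij ◅ j⋆) =
    star-closed closed (closed (x∈p∪q⁺ (inj₂ (∈-decSubset⁺ (successor? _) (_ , i∈p , Rij))))) j⋆

  star? : Decidable (Star R)
  star? i j with iterate-closes ⁅ i ⁆
  ... | m , closed = map′ sound complete (j ∈? iterate expand ⁅ i ⁆ m)
    where
    sound : j ∈ iterate expand ⁅ i ⁆ m → Star R i j
    sound j∈ with ∈-iterate-expand⇒reachable m ⁅ i ⁆ j∈
    ... | l , l∈⁅i⁆ , l⋆j with refl ← x∈⁅y⁆⇒x≡y i l∈⁅i⁆ = l⋆j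
    complete : Star R i j → j ∈ iterate expand ⁅ i ⁆ m
    complete = star-closed closed (⊆-iterate m ⁅ i ⁆ (x∈⁅x⁆ i))

record εNFA (A : Set) : Set₁ where
  field
    size     : ℕ
    Initial  : Fin size → Set
    Final    : Fin size → Set
    _⟶ε_    : Rel (Fin size) 0ℓ
    _⟶[_]_  : Fin size → A → Fin size → Set
    initial? : ∀ i → Dec (Initial i)
    final?   : ∀ i → Dec (Final i)
    ε?       : Decidable _⟶ε_
    step?    : ∀ i a j → Dec (i ⟶[ a ] j)

module _ {A : Set} (M : εNFA A) where
  open εNFA M

  data Accepts : Fin size → List A → Set where
    done   : ∀ {i} → Final i → Accepts i []
    ε-move : ∀ {i j w} → i ⟶ε j → Accepts j w → Accepts i w
    read   : ∀ {i j a w} → i ⟶[ a ] j → Accepts j w → Accepts i (a ∷ w)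

  εLang : Language A
  εLang w = Σ (Fin size) λ i → Initial i × Accepts i w

  closure-final? : ∀ i → Dec (∃ λ j → Star _⟶ε_ i j × Final j)
  closure-final? i = any? λ j → star? ε? i j ×-dec final? j

  closure-step? : ∀ i a j → Dec (∃ λ l → Star _⟶ε_ i l × l ⟶[ a ] j)
  closure-step? i a j = any? λ l → star? ε? i l ×-dec step? l a j

  eliminateε : NFA A
  eliminateε = record
    { nStates = size
    ; initial = λ i → does (initial? i)
    ; final   = λ i → does (closure-final? i)
    ; δ       = λ i a j → does (closure-step? i a j)
    }

  star-accepts : ∀ {i j w} → Star _⟶ε_ i j → Accepts j w → Accepts i w
  star-accepts ε         acc = acc
  star-accepts (e ◅ i⋆j) acc = ε-move e (star-accepts i⋆j acc)

  Run→Accepts : ∀ {i w} → Run eliminateε i w → Accepts i w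
  Run→Accepts {i} (stop fin) with does-true (closure-final? i) fin
  ... | j , i⋆j , finj = star-accepts i⋆j (done finj)
  Run→Accepts {i} (move {q' = j} {a = a} δij run) with does-true (closure-step? i a j) δij
  ... | l , i⋆l , l⟶j = star-accepts i⋆l (read l⟶j (Run→Accepts run))

  Accepts→Run : ∀ {i j w} → Star _⟶ε_ i j → Accepts j w → Run eliminateε i w
  Accepts→Run i⋆j (done finj)     = stop (dec-true (closure-final? _) (_ , i⋆j , finj))
  Accepts→Run i⋆j (ε-move e acc)  = Accepts→Run (i⋆j ◅◅ e ◅ ε) acc
  Accepts→Run i⋆j (read j⟶l acc) =
    move (dec-true (closure-step? _ _ _) (_ , i⋆j , j⟶l)) (Accepts→Run ε acc)

  eliminateε-correct : ∀ w → NFALang eliminateε w ⇔ εLang w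
  eliminateε-correct w = mk⇔
    (λ (i , init , run) → i , does-true (initial? i) init , Run→Accepts run)
    (λ (i , init , acc) → i , dec-true (initial? i) init , Accepts→Run ε acc)

Bounded : (n : ℕ) → (Fin n → ℕ) → Set
Bounded n β = Σ (Fin n → ℕ) λ ξ → ∀ x → ξ x ≤ β x

#Bounded : (n : ℕ) → (Fin n → ℕ) → ℕ
#Bounded zero    β = 1
#Bounded (suc n) β = suc (β zero) * #Bounded n (β ∘ suc)

toIndex : ∀ {n} β → Bounded n β → Fin (#Bounded n β)
toIndex {zero}  β _         = zero
toIndex {suc n} β (ξ , ξ≤β) =
  combine (fromℕ< (s≤s (ξ≤β zero))) (toIndex (β ∘ suc) (ξ ∘ suc , ξ≤β ∘ suc))

consBounded : ∀ {n β} → Fin (suc (β zero)) → Bounded n (β ∘ suc) → Bounded (suc n) β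
consBounded h (ξ , ξ≤β) =
  (λ { zero → toℕ h ; (suc x) → ξ x }) , (λ { zero → ≤-pred (toℕ<n h) ; (suc x) → ξ≤β x })

fromIndex : ∀ {n} β → Fin (#Bounded n β) → Bounded n β
fromIndex {zero}  β _ = (λ ()) , (λ ())
fromIndex {suc n} β c =
  uncurry consBounded (map₂ (fromIndex (β ∘ suc)) (remQuot (#Bounded n (β ∘ suc)) c))

fromIndex-toIndex : ∀ {n} β (ξ : Bounded n β) → proj₁ (fromIndex β (toIndex β ξ)) ≗ proj₁ ξ
fromIndex-toIndex {suc n} β (ξ , ξ≤β) x = begin
  proj₁ (fromIndex β (combine h t)) x
    ≡⟨ cong (λ (h , t) → proj₁ (consBounded h (fromIndex (β ∘ suc) t)) x) (remQuot-combine h t) ⟩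
  proj₁ (consBounded h (fromIndex (β ∘ suc) t)) x
    ≡⟨ head-or-tail x ⟩
  ξ x ∎
  where
  h = fromℕ< (s≤s (ξ≤β zero))
  t = toIndex (β ∘ suc) (ξ ∘ suc , ξ≤β ∘ suc)
  head-or-tail : ∀ x → proj₁ (consBounded h (fromIndex (β ∘ suc) t)) x ≡ ξ x
  head-or-tail zero    = toℕ-fromℕ< (s≤s (ξ≤β zero))
  head-or-tail (suc y) = fromIndex-toIndex (β ∘ suc) (ξ ∘ suc , ξ≤β ∘ suc) y

⊓-absorbs-shift : ∀ m n o → (m ⊓ n + o) ⊓ n ≡ (m + o) ⊓ n
⊓-absorbs-shift m n o = begin
  (m ⊓ n + o) ⊓ n         ≡⟨ cong (_⊓ n) (+-distribʳ-⊓ o m n) ⟩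
  (m + o) ⊓ (n + o) ⊓ n   ≡⟨ ⊓-assoc (m + o) (n + o) n ⟩
  (m + o) ⊓ ((n + o) ⊓ n) ≡⟨ cong ((m + o) ⊓_) (m≥n⇒m⊓n≡n (m≤m+n n o)) ⟩
  (m + o) ⊓ n             ∎

encodeAssign-cong : ∀ n β {ξ ξ'} → ξ ≗ ξ' → encodeAssign n β ξ ≡ encodeAssign n β ξ'
encodeAssign-cong zero    β ξ≗ξ' = refl
encodeAssign-cong (suc n) β ξ≗ξ' =
  cong₂ _++_ (cong (encodeNat _) (ξ≗ξ' zero)) (encodeAssign-cong n (β ∘ suc) (ξ≗ξ' ∘ suc))

module _ {s : ℕ} (𝔸 : SWA s) where
  open SWA 𝔸
  open SWASemantics 𝔸

  Accepting : Node → List (Fin (suc s)) → Set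
  Accepting n w = Σ Assignment λ ξ → Computation n (accept , ξ) w

module ConfigurationGraph {s : ℕ} (𝔸 : SWA s) where
  open SWA 𝔸
  open SWASemantics 𝔸

  record _≈_ (n n' : Node) : Set where
    constructor _,_
    field
      same-state  : proj₁ n ≡ proj₁ n'
      same-clocks : proj₁ (proj₂ n) ≗ proj₁ (proj₂ n')

  ≈-refl : ∀ n → n ≈ n
  ≈-refl n = refl , λ _ → refl

  ≈-sym : ∀ {n n'} → n ≈ n' → n' ≈ n
  ≈-sym (refl , ξ≗ξ') = refl , sym ∘ ξ≗ξ'

  _≈?_ : Decidable _≈_
  (q , ξ) ≈? (q' , ξ') = map′ (uncurry _,_) (λ (q≡q' , ξ≗ξ') → q≡q' , ξ≗ξ')
                           ((q ≟ᶠ q') ×-dec all? (λ x → proj₁ ξ x ≟ℕ proj₁ ξ' x))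

  advance : Fin nQ → ℕ → (Fin nX → ℕ) → Fin nX → ℕ
  advance q t ξ x = if active x q then (ξ x + t) ⊓ bound x else ξ x

  advance-cong : ∀ q t {ξ ξ'} → ξ ≗ ξ' → advance q t ξ ≗ advance q t ξ'
  advance-cong q t ξ≗ξ' x = cong (λ v → if active x q then (v + t) ⊓ bound x else v) (ξ≗ξ' x)

  advance-suc : ∀ q t ξ → advance q (suc t) ξ ≗ advance q t (advance q 1 ξ)
  advance-suc q t ξ x with active x q
  ... | true  = begin
    (ξ x + suc t) ⊓ bound x             ≡⟨ cong (_⊓ bound x) (sym (+-assoc (ξ x) 1 t)) ⟩
    (ξ x + 1 + t) ⊓ bound x             ≡⟨ ⊓-absorbs-shift (ξ x + 1) (bound x) t ⟨
    ((ξ x + 1) ⊓ bound x + t) ⊓ bound x ∎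
  ... | false = refl

  tick : Fin nQ → Assignment → Assignment
  tick q (ξ , ξ≤β) = advance q 1 ξ , within
    where
    within : ∀ x → advance q 1 ξ x ≤ bound x
    within x with active x q
    ... | true  = m⊓n≤n _ _
    ... | false = ξ≤β x

  Edge-resp : ∀ {n t n' m m'} → Edge n t n' → n ≈ m → n' ≈ m' → Edge m t m'
  Edge-resp {_ , ξ} {m = _ , η} (discrete tr tr∈Δ src tgt guard action) (refl , ξ≗η) (refl , ξ'≗η')
    rewrite encodeAssign-cong nX bound ξ≗η =
      discrete tr tr∈Δ src tgt guard (λ x → trans (sym (ξ'≗η' x)) (action x))
  Edge-resp {q , ξ} {t} (delay 0<t d) (refl , ξ≗η) (refl , ξ'≗η') =
    delay 0<t (λ x → trans (sym (ξ'≗η' x)) (trans (d x) (advance-cong q t ξ≗η x)))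

  Fires : Node → Node → Transition nQ (width nX bound) → Set
  Fires (q , ξ) (q' , ξ') tr =
    Transition.source tr ≡ q × Transition.target tr ≡ q' ×
    lookup (evalCircuit (Transition.guard tr) (enc ξ)) zero ≡ true ×
    (∀ x → proj₁ ξ' x ≡ decodeAssign nX bound (evalCircuit (Transition.action tr) (enc ξ)) x ⊓ bound x)

  fires? : ∀ n n' tr → Dec (Fires n n' tr)
  fires? (q , ξ) (q' , ξ') tr =
    (Transition.source tr ≟ᶠ q) ×-dec (Transition.target tr ≟ᶠ q') ×-dec
    (_ ≟ᵇ true) ×-dec all? (λ x → proj₁ ξ' x ≟ℕ _)

  discrete? : ∀ n n' → Dec (Edge n 0 n')
  discrete? n n' = map′ fromAny toAny (anyᴸ? (fires? n n') Δ)
    where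
    fromAny : Any (Fires n n') Δ → Edge n 0 n'
    fromAny any with find any
    ... | tr , tr∈Δ , src , tgt , guard , action = discrete tr tr∈Δ src tgt guard action
    toAny : Edge n 0 n' → Any (Fires n n') Δ
    toAny (discrete tr tr∈Δ src tgt guard action) = lose tr∈Δ (src , tgt , guard , action)

  delay? : ∀ n t n' → Dec (Edge n (suc t) n')
  delay? (q , ξ) t (q' , ξ') =
    map′ fromDelay toDelay ((q ≟ᶠ q') ×-dec all? (λ x → proj₁ ξ' x ≟ℕ advance q (suc t) (proj₁ ξ) x))
    where
    fromDelay : q ≡ q' × proj₁ ξ' ≗ advance q (suc t) (proj₁ ξ) → Edge (q , ξ) (suc t) (q' , ξ')
    fromDelay (refl , d) = delay (s≤s z≤n) d
    toDelay : Edge (q , ξ) (suc t) (q' , ξ') → q ≡ q' × proj₁ ξ' ≗ advance q (suc t) (proj₁ ξ)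
    toDelay (delay _ d) = refl , d

  #Nodes : ℕ
  #Nodes = nQ * #Bounded nX bound

  node : Fin #Nodes → Node
  node c = map₂ (fromIndex bound) (remQuot (#Bounded nX bound) c)

  index : Node → Fin #Nodes
  index (q , ξ) = combine q (toIndex bound ξ)

  node-index : ∀ n → node (index n) ≈ n
  node-index (q , ξ) =
    cong proj₁ split ,
    λ x → trans (cong (λ (_ , i) → proj₁ (fromIndex bound i) x) split) (fromIndex-toIndex bound ξ x)
    where split = remQuot-combine {k = #Bounded nX bound} q (toIndex bound ξ)

  configurations : εNFA (Fin (suc s))
  configurations = record
    { size     = #Nodes
    ; Initial  = λ c → node c ≈ (start , zeroAssign)
    ; Final    = λ c → proj₁ (node c) ≡ accept
    ; _⟶ε_    = λ c c' → proj₁ (node c) ≢ accept × Edge (node c) 0 (node c')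
    ; _⟶[_]_  = λ c a c' → proj₁ (node c) ≢ accept × label (proj₁ (node c)) ≡ a × Edge (node c) 1 (node c')
    ; initial? = λ c → node c ≈? (start , zeroAssign)
    ; final?   = λ c → proj₁ (node c) ≟ᶠ accept
    ; ε?       = λ c c' → ¬? (proj₁ (node c) ≟ᶠ accept) ×-dec discrete? (node c) (node c')
    ; step?    = λ c a c' → ¬? (proj₁ (node c) ≟ᶠ accept) ×-dec (label (proj₁ (node c)) ≟ᶠ a)
                              ×-dec delay? (node c) 0 (node c')
    }

  stop-at-accept : ∀ {q ξ} → q ≡ accept → Accepting 𝔸 (q , ξ) []
  stop-at-accept refl = _ , here

  Accepting-resp : ∀ {n n' w} → Accepting 𝔸 n w → n ≈ n' → Accepting 𝔸 n' w
  Accepting-resp (_ , here) (q≡q' , _) = stop-at-accept (sym q≡q')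
  Accepting-resp (ξ , next q≢acc e comp) n≈n'@(refl , _) = ξ , next q≢acc (Edge-resp e n≈n' (≈-refl _)) comp

  accepts→computation : ∀ {c w} → Accepts configurations c w → Accepting 𝔸 (node c) w
  accepts→computation (done q≡acc)                 = stop-at-accept q≡acc
  accepts→computation (ε-move (q≢acc , e) acc)      = map₂ (next q≢acc e) (accepts→computation acc)
  accepts→computation (read (q≢acc , refl , e) acc) = map₂ (next q≢acc e) (accepts→computation acc)

  unit-delay : ∀ {c q ξ ξ'} → node c ≈ (q , ξ) → proj₁ ξ' ≗ advance q 1 (proj₁ ξ) →
               Edge (node c) 1 (node (index (q , ξ')))
  unit-delay {q = q} {ξ} {ξ'} c≈ d = Edge-resp (delay {ξ = ξ} (s≤s z≤n) d) (≈-sym c≈) (≈-sym (node-index (q , ξ')))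

  ticks : ∀ t {q ξ ξ' w} → q ≢ accept → proj₁ ξ' ≗ advance q (suc t) (proj₁ ξ) →
          (∀ c' → node c' ≈ (q , ξ') → Accepts configurations c' w) →
          ∀ c → node c ≈ (q , ξ) → Accepts configurations c (replicate (suc t) (label q) ++ᴸ w)
  ticks zero {q} {ξ' = ξ'} q≢acc d continue c c≈@(refl , _) =
    read (q≢acc , refl , unit-delay c≈ d) (continue (index (q , ξ')) (node-index (q , ξ')))
  ticks (suc t) {q} {ξ} q≢acc d continue c c≈@(refl , _) =
    read (q≢acc , refl , unit-delay c≈ λ _ → refl)
         (ticks t q≢acc (λ x → trans (d x) (advance-suc q (suc t) (proj₁ ξ) x)) continue
                (index (q , tick q ξ)) (node-index (q , tick q ξ)))

  computation→accepts : ∀ {n ξf w} → Computation n (accept , ξf) w →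
                        ∀ c → node c ≈ n → Accepts configurations c w
  computation→accepts here c (q≡acc , _) = done q≡acc
  computation→accepts (next {t = zero} {n = n'} q≢acc e comp) c c≈@(refl , _) =
    ε-move (q≢acc , Edge-resp e (≈-sym c≈) (≈-sym (node-index n')))
           (computation→accepts comp (index n') (node-index n'))
  computation→accepts (next {t = suc t} q≢acc (delay _ d) comp) c c≈ =
    ticks t q≢acc d (computation→accepts comp) c c≈

  configurations-correct : ∀ w → SWALang w ⇔ εLang configurations w
  configurations-correct w = mk⇔
    (λ (_ , comp) → index (start , zeroAssign) , node-index _ , computation→accepts comp _ (node-index _))
    (λ (c , init , acc) → Accepting-resp (accepts→computation acc) init)

-- Guards see the stopwatch, which never exceeds 2, as two bits with the least significant first:
-- clockIs1 reads the low bit and clockIs0 checks that neither bit is set.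
clockIs0 clockIs1 never : Circuit 2 1
clockIs0 = circuit 2 (([] ▷ ∨g zero (suc zero)) ▷ ¬g zero) (zero ∷ [])
clockIs1 = circuit 0 [] (zero ∷ [])
never    = circuit 1 ([] ▷ const false) (zero ∷ [])

reset : Circuit 2 2
reset = circuit 1 ([] ▷ const false) (zero ∷ zero ∷ [])

module FromNFA {s : ℕ} (N : NFA (Fin (suc s))) where
  open NFA N renaming (nStates to n)

  #States : ℕ
  #States = 2 + suc s * n

  startState acceptState : Fin #States
  startState  = zero
  acceptState = suc zero

  reading : Fin (suc s) → Fin n → Fin #States
  reading a p = suc (suc (combine a p))

  letter : Fin (suc s * n) → Fin (suc s)
  letter c = proj₁ (remQuot {suc s} n c)

  target : Fin (suc s * n) → Fin n
  target c = proj₂ (remQuot {suc s} n c)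

  labelOf : Fin #States → Fin (suc s)
  labelOf (suc (suc c)) = letter c
  labelOf _             = zero

  initially-final? : Dec (∃ λ p → initial p ≡ true × final p ≡ true)
  initially-final? = any? λ p → (initial p ≟ᵇ true) ×-dec (final p ≟ᵇ true)

  initially-reads? : ∀ a p' → Dec (∃ λ p → initial p ≡ true × δ p a p' ≡ true)
  initially-reads? a p' = any? λ p → (initial p ≟ᵇ true) ×-dec (δ p a p' ≟ᵇ true)

  enabled : Fin #States → Fin #States → Bool
  enabled zero          (suc zero)     = does initially-final?
  enabled zero          (suc (suc c')) = does (initially-reads? (letter c') (target c'))
  enabled (suc (suc c)) (suc zero)     = final (target c)
  enabled (suc (suc c)) (suc (suc c')) = δ (target c) (letter c') (target c')
  enabled _             _              = false

  wait : Fin #States → ℕ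
  wait zero    = 0
  wait (suc _) = 1

  clockIs : Fin #States → Circuit 2 1
  clockIs zero    = clockIs0
  clockIs (suc _) = clockIs1

  transition : Fin #States → Fin #States → Transition #States 2
  transition q q' = record
    { source = q ; guard = if enabled q q' then clockIs q else never ; action = reset ; target = q' }

  automaton : SWA s
  automaton = record
    { nQ     = #States
    ; start  = startState
    ; accept = acceptState
    ; label  = labelOf
    ; nX     = 1
    ; bound  = λ _ → 2
    ; active = λ _ _ → true
    ; Δ      = cartesianProductWith transition (allFin #States) (allFin #States)
    }

  open SWASemantics automaton

  clock : Assignment → ℕ
  clock ξ = proj₁ ξ zero

  guardHolds : Circuit 2 1 → Assignment → Bool
  guardHolds g ξ = lookup (evalCircuit g (enc ξ)) zero

  clockIs-sound : ∀ q (ξ : Assignment) → guardHolds (clockIs q) ξ ≡ true → clock ξ ≡ wait q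
  clockIs-sound q (ξ , ξ≤2) holds with ξ zero | ξ≤2 zero | q | holds
  ... | 0 | _ | zero  | _ = refl
  ... | 1 | _ | suc _ | _ = refl
  ... | 0 | _ | suc _ | ()
  ... | 1 | _ | zero  | ()
  ... | 2 | _ | zero  | ()
  ... | 2 | _ | suc _ | ()
  ... | suc (suc (suc _)) | s≤s (s≤s ()) | _ | _

  clockIs-complete : ∀ q (ξ : Assignment) → clock ξ ≡ wait q → guardHolds (clockIs q) ξ ≡ true
  clockIs-complete zero    _ ≡wait rewrite ≡wait = refl
  clockIs-complete (suc _) _ ≡wait rewrite ≡wait = refl

  guarded : ∀ b g ξ → guardHolds (if b then g else never) ξ ≡ true → b ≡ true × guardHolds g ξ ≡ true
  guarded true g ξ holds = refl , holds

  fire : ∀ {q q' ξ} → enabled q q' ≡ true → clock ξ ≡ wait q → Edge (q , ξ) 0 (q' , zeroAssign)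
  fire {q} {q'} {ξ} on ≡wait =
    discrete (transition q q') (∈-cartesianProductWith⁺ transition (∈-allFin q) (∈-allFin q'))
             refl refl holds (λ { zero → refl })
    where
    holds : guardHolds (if enabled q q' then clockIs q else never) ξ ≡ true
    holds rewrite on = clockIs-complete q ξ ≡wait

  fired : ∀ {q q' ξ ξ'} → Edge (q , ξ) 0 (q' , ξ') →
          enabled q q' ≡ true × clock ξ ≡ wait q × clock ξ' ≡ 0
  fired {q} {q'} {ξ} (discrete tr tr∈Δ src tgt holds reset≡)
    with ∈-cartesianProductWith⁻ transition (allFin _) (allFin _) tr∈Δ
  ... | _ , _ , _ , _ , refl with refl ← src | refl ← tgt with guarded (enabled q q') (clockIs q) ξ holds
  ...   | on , holds′ = on , clockIs-sound q ξ holds′ , reset≡ zero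

  delayed-clock : ∀ {ξ ξ' : Assignment} {v t} → clock ξ ≡ v →
                  (∀ x → proj₁ ξ' x ≡ (proj₁ ξ x + t) ⊓ 2) → (v + t) ⊓ 2 ≡ clock ξ'
  delayed-clock {t = t} ≡v d = sym (trans (d zero) (cong (λ u → (u + t) ⊓ 2) ≡v))

  clockOne : Assignment
  clockOne = (λ _ → 1) , (λ _ → s≤s z≤n)

  label-reading : ∀ a p → labelOf (reading a p) ≡ a
  label-reading a p = cong proj₁ (remQuot-combine a p)

  enabled-start-reading : ∀ a p → enabled startState (reading a p) ≡ does (initially-reads? a p)
  enabled-start-reading a p = cong (λ (a , p) → does (initially-reads? a p)) (remQuot-combine a p)

  enabled-reading-accept : ∀ a p → enabled (reading a p) acceptState ≡ final p
  enabled-reading-accept a p = cong (final ∘ proj₂) (remQuot-combine a p)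

  enabled-reading-reading : ∀ a p a' p' → enabled (reading a p) (reading a' p') ≡ δ p a' p'
  enabled-reading-reading a p a' p' =
    trans (cong (λ (_ , p) → δ p _ _) (remQuot-combine a p)) (cong (λ (a' , p') → δ p a' p') (remQuot-combine a' p'))

  run→afterTick  : ∀ a p {w} → Run N p w → Accepting automaton (reading a p , clockOne) w
  run→beforeTick : ∀ a p {w} → Run N p w → Accepting automaton (reading a p , zeroAssign) (a ∷ w)

  run→afterTick a p (stop fin) =
    zeroAssign , next (λ ()) (fire (trans (enabled-reading-accept a p) fin) refl) here
  run→afterTick a p (move {q' = p'} {a = a'} step run) =
    map₂ (next (λ ()) (fire (trans (enabled-reading-reading a p a' p') step) refl)) (run→beforeTick a' p' run)

  run→beforeTick a p {w} run =
    subst (λ b → Accepting automaton (reading a p , zeroAssign) (b ∷ w)) (label-reading a p)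
          (map₂ (next (λ ()) (delay {ξ = zeroAssign} (s≤s z≤n) λ { zero → refl })) (run→afterTick a p run))

  run→computation : ∀ {w} → NFALang N w → SWALang w
  run→computation (p , init , stop fin) =
    zeroAssign , next (λ ()) (fire (dec-true initially-final? (p , init , fin)) refl) here
  run→computation (p , init , move {q' = p'} {a = a} step run) =
    map₂ (next (λ ()) (fire (trans (enabled-start-reading a p') (dec-true (initially-reads? a p') (p , init , step)))
                            refl))
         (run→beforeTick a p' run)

  accept-stops : ∀ {ξ ξf w} → Computation (acceptState , ξ) (acceptState , ξf) w → w ≡ []
  accept-stops here             = refl
  accept-stops (next q≢acc _ _) = ⊥-elim (q≢acc refl)

  overdue-blocks : ∀ {q ξ ξf w} → q ≢ acceptState → wait q < clock ξ →
                   Computation (q , ξ) (acceptState , ξf) w → ⊥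
  overdue-blocks q≢acc _    here                    = q≢acc refl
  overdue-blocks q≢acc late (next {t = zero} _ e _) = <-irrefl (sym (proj₁ (proj₂ (fired e)))) late
  overdue-blocks {ξ = ξ} q≢acc late (next {t = suc t} _ (delay _ d) comp) =
    overdue-blocks q≢acc (<-≤-trans late (≤-trans (⊓-glb (m≤m+n (clock ξ) (suc t)) (proj₂ ξ zero))
                                                  (≤-reflexive (sym (d zero)))))
                   comp

  afterTick→run  : ∀ c {ξ ξf w} → clock ξ ≡ 1 → Computation (suc (suc c) , ξ) (acceptState , ξf) w →
                   Run N (target c) w
  beforeTick→run : ∀ c {ξ ξf w} → clock ξ ≡ 0 → Computation (suc (suc c) , ξ) (acceptState , ξf) w →
                   ∃ λ w' → w ≡ letter c ∷ w' × Run N (target c) w'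

  -- In the overdue cases, (v + suc t) ⊓ 2 computes to suc (suc _) once v or t is positive.
  afterTick→run c ≡1 (next {t = zero} {n = zero , _} _ e _) with () ← proj₁ (fired e)
  afterTick→run c ≡1 (next {t = zero} {n = suc zero , _} _ e comp)
    with refl ← accept-stops comp = stop (proj₁ (fired e))
  afterTick→run c ≡1 (next {t = zero} {n = suc (suc c') , _} _ e comp) with fired e
  ... | step , _ , cleared with beforeTick→run c' cleared comp
  ...   | _ , refl , run = move step run
  afterTick→run c ≡1 (next {t = suc t} _ (delay {ξ = ξ} {ξ' = ξ'} _ d) comp) =
    ⊥-elim (overdue-blocks (λ ()) (subst (1 <_) (delayed-clock {ξ} {ξ'} ≡1 d) (s≤s (s≤s z≤n))) comp)

  beforeTick→run c ≡0 (next {t = zero} _ e _) with () ← trans (sym ≡0) (proj₁ (proj₂ (fired e)))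
  beforeTick→run c ≡0 (next {t = 1} _ (delay {ξ = ξ} {ξ' = ξ'} _ d) comp) =
    _ , refl , afterTick→run c (sym (delayed-clock {ξ} {ξ'} ≡0 d)) comp
  beforeTick→run c ≡0 (next {t = suc (suc t)} _ (delay {ξ = ξ} {ξ' = ξ'} _ d) comp) =
    ⊥-elim (overdue-blocks (λ ()) (subst (1 <_) (delayed-clock {ξ} {ξ'} ≡0 d) (s≤s (s≤s z≤n))) comp)

  computation→run : ∀ {ξ ξf w} → clock ξ ≡ 0 → Computation (startState , ξ) (acceptState , ξf) w → NFALang N w
  computation→run ≡0 (next {t = zero} {n = zero , _} _ e _) with () ← proj₁ (fired e)
  computation→run ≡0 (next {t = zero} {n = suc zero , _} _ e comp)
    with refl ← accept-stops comp | p , init , fin ← does-true initially-final? (proj₁ (fired e)) =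
      p , init , stop fin
  computation→run ≡0 (next {t = zero} {n = suc (suc c') , _} _ e comp) with fired e
  ... | on , _ , cleared with beforeTick→run c' cleared comp | does-true (initially-reads? _ _) on
  ...   | _ , refl , run | p , init , step = p , init , move step run
  computation→run ≡0 (next {t = suc t} _ (delay {ξ = ξ} {ξ' = ξ'} _ d) comp) =
    ⊥-elim (overdue-blocks (λ ()) (subst (0 <_) (delayed-clock {ξ} {ξ'} ≡0 d) (s≤s z≤n)) comp)

  automaton-correct : ∀ w → NFALang N w ⇔ SWALang w
  automaton-correct w = mk⇔ run→computation (λ (_ , comp) → computation→run refl comp)

mainTheorem3 : (s : ℕ) (L : Language (Fin (suc s))) →
    Regular L ⇔ Σ (SWA s) (λ 𝔸 → ∀ w → L w ⇔ SWASemantics.SWALang 𝔸 w)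
mainTheorem3 s L = mk⇔
  (λ (N , L⇔N) → automaton N , λ w → automaton-correct N w ⇔-∘ L⇔N w)
  (λ (𝔸 , L⇔𝔸) → eliminateε (configurations 𝔸) ,
     λ w → ⇔-sym (eliminateε-correct (configurations 𝔸) w) ⇔-∘ (configurations-correct 𝔸 w ⇔-∘ L⇔𝔸 w))
  where
  open FromNFA using (automaton; automaton-correct)
  open ConfigurationGraph using (configurations; configurations-correct)
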